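{- Consider the $K$-medoids problem on samples $x(1),\ldots,x(N)$ (with $1\le K<N$) lying in a metric space with metric $\mathrm{dist}$, with dissimilarity $f(x(i),x(j))=e(\mathrm{dist}(x(i),x(j)))$, where $e:\mathbb{R}_{\ge 0}\to\mathbb{R}_{\ge 0}$ satisfies $e(0)=0$ and $v_1\le v_2 \iff e(v_1)\le e(v_2)$. For a set $\mathcal{C}\subset\{1,\ldots,N\}$ of $K$ center indices, define the energy $E(\mathcal{C})=\frac1N\sum_{i=1}^N\min_{i'\in\mathcal{C}} f(x(i),x(i'))$. (1) If $\mathcal{C}$ is a local minimum of \texttt{clarans} (that is, for every $i_-\in\mathcal{C}$ and every $i_+\in\{1,\ldots,N\}\setminus\mathcal{C}$ one has $E(\mathcal{C}\setminus\{i_-\}\cup\{i_+\})\ge E(\mathcal{C})$), then $\mathcal{C}$ is a local minimum of \texttt{medlloyd} (that is, for each center $c\in\mathcal{C}$, $c$ is a medoid of its cluster: $\sum_{i\in S_c} f(x(i),x(c))\le \sum_{i\in S_c} f(x(i),x(m))$ for every $m\in S_c$, where the clusters $S_c$, $c\in\mathcal{C}$, partition $\{1,\ldots,N\}$ by assigning each index to a center in $\mathcal{C}$ at minimal dissimilarity, ties broken arbitrarily except that each center index $c$ is assigned to its own cluster $S_c$). (2) There exist instances (e.g. with points in Euclidean space and $f$ the squared Euclidean distance) and center sets $\mathcal{C}$ that are local minima of \texttt{medlloyd} but not local minima of \texttt{clarans}.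
   Context: \texttt{medlloyd} (also called \texttt{vik}, the Voronoi iteration algorithm) is the $K$-medoids analogue of Lloyd's algorithm: it alternates between assigning each sample to its nearest current center and replacing each center by the medoid of its cluster, i.e. the cluster member minimizing the sum of dissimilarities to the other members of the cluster; its local minima (fixed points) are configurations in which every center is already a medoid of its cluster. \texttt{clarans} is the swap-based $K$-medoids algorithm that repeatedly proposes replacing a center index $i_-\in\mathcal{C}$ by a non-center index $i_+\notin\mathcal{C}$ and accepts the swap only if the energy $E$ strictly decreases; its local minima are configurations from which no such swap decreases $E$. -}

module Defs where

open import Level using (Level; _⊔_) renaming (suc to lsuc)
open import Data.Nat as ℕ using (ℕ)
open import Data.Fin using (Fin; zero; suc)
open import Data.Fin.Subset using (Subset; _∈_; _∉_; ∣_∣; _-_; _∪_; ⁅_⁆)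
open import Data.Bool using (Bool; true; false; if_then_else_)
open import Data.Maybe using (Maybe; just; nothing)
open import Data.Product using (_×_; Σ; _,_)
open import Relation.Nullary using (¬_; does)
open import Relation.Binary.PropositionalEquality using (_≡_)
open import Relation.Binary.Structures using (IsTotalOrder)
open import Algebra.Structures using (IsCommutativeRing)
open import Data.Fin using (_≟_)
open import Function.Bundles using (_⇔_)
open import Data.Sum using (inj₁; inj₂)
open import Data.Vec using (_∷_)

-- The reals are not available in agda-stdlib, so the
-- theorem is stated for an arbitrary (totally) ordered field, of which
-- ℝ is an instance.  The multiplicative inverse is total with the
-- usual law for nonzero elements (the value at 0 is irrelevant).

record OrderedField (c ℓ : Level) : Set (lsuc (c ⊔ ℓ)) where
  infixl 7 _*_
  infixl 6 _+_
  infix  4 _≤_ _<_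
  field
    Carrier : Set c
    _+_ _*_ : Carrier → Carrier → Carrier
    -_      : Carrier → Carrier
    0# 1#   : Carrier
    _⁻¹     : Carrier → Carrier
    _≤_     : Carrier → Carrier → Set ℓ
    isCommutativeRing : IsCommutativeRing _≡_ _+_ _*_ -_ 0# 1#
    ⁻¹-inverse : ∀ x → ¬ (x ≡ 0#) → x * (x ⁻¹) ≡ 1#
    0≢1        : ¬ (0# ≡ 1#)
    isTotalOrder : IsTotalOrder _≡_ _≤_
    +-mono-≤     : ∀ {x y} z → x ≤ y → x + z ≤ y + z
    *-nonneg     : ∀ {x y} → 0# ≤ x → 0# ≤ y → 0# ≤ x * y

  _<_ : Carrier → Carrier → Set (c ⊔ ℓ)
  x < y = (x ≤ y) × ¬ (x ≡ y)

  fromℕ : ℕ → Carrier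
  fromℕ ℕ.zero    = 0#
  fromℕ (ℕ.suc n) = 1# + fromℕ n

module _ {c ℓ : Level} (F : OrderedField c ℓ) where
  open OrderedField F

  record IsMetric {a} {X : Set a} (dist : X → X → Carrier) : Set (a ⊔ c ⊔ ℓ) where
    field
      nonneg   : ∀ x y → 0# ≤ dist x y
      zero⇔eq  : ∀ x y → (dist x y ≡ 0#) ⇔ (x ≡ y)
      sym      : ∀ x y → dist x y ≡ dist y x
      triangle : ∀ x y z → dist x z ≤ dist x y + dist y z

  -- e : ℝ≥0 → ℝ≥0 with e(0)=0 and v₁ ≤ v₂ ⇔ e(v₁) ≤ e(v₂) (on ℝ≥0).
  -- e is given as a function on the whole field; only its behaviour
  -- on nonnegative arguments is constrained (and used).
  record IsAdmissible (e : Carrier → Carrier) : Set (c ⊔ ℓ) where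
    field
      nonneg : ∀ v → 0# ≤ v → 0# ≤ e v
      e0     : e 0# ≡ 0#
      mono⇔  : ∀ v₁ v₂ → 0# ≤ v₁ → 0# ≤ v₂ → (v₁ ≤ v₂) ⇔ (e v₁ ≤ e v₂)

  sumF : ∀ {n} → (Fin n → Carrier) → Carrier
  sumF {ℕ.zero}  g = 0#
  sumF {ℕ.suc n} g = g zero + sumF (λ i → g (suc i))

  min₂ : Carrier → Carrier → Carrier
  min₂ x y with IsTotalOrder.total isTotalOrder x y
  ... | inj₁ _ = x
  ... | inj₂ _ = y

  minOnM : ∀ {n} → Subset n → (Fin n → Carrier) → Maybe Carrier
  minOnM {ℕ.zero}  _ g = nothing
  minOnM {ℕ.suc n} (b ∷ p) g with b | minOnM p (λ i → g (suc i))
  ... | false | r       = r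
  ... | true  | nothing = just (g zero)
  ... | true  | just m  = just (min₂ (g zero) m)

  -- min over a subset; the default 0# for the empty subset is never
  -- used in the theorem (all center sets considered have K ≥ 1 elements)
  minOn : ∀ {n} → Subset n → (Fin n → Carrier) → Carrier
  minOn p g with minOnM p g
  ... | just m  = m
  ... | nothing = 0#

  module KMedoids (N : ℕ) (f : Fin N → Fin N → Carrier) where

    energy : Subset N → Carrier
    energy 𝒞 = (fromℕ N) ⁻¹ * sumF (λ i → minOn 𝒞 (f i))

    ClaransLocalMin : Subset N → Set ℓ
    ClaransLocalMin 𝒞 = ∀ i₋ i₊ → i₋ ∈ 𝒞 → i₊ ∉ 𝒞 →
      energy 𝒞 ≤ energy ((𝒞 - i₋) ∪ ⁅ i₊ ⁆)

    -- a valid cluster assignment: a i is the center of the cluster of i;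
    -- it is a center at minimal dissimilarity, and centers are assigned
    -- to themselves (ties otherwise broken arbitrarily)
    record IsAssignment (𝒞 : Subset N) (a : Fin N → Fin N) : Set ℓ where
      field
        inC     : ∀ i → a i ∈ 𝒞
        nearest : ∀ i c → c ∈ 𝒞 → f i (a i) ≤ f i c
        selfC   : ∀ c → c ∈ 𝒞 → a c ≡ c

    clusterSum : (a : Fin N → Fin N) → Fin N → (Fin N → Carrier) → Carrier
    clusterSum a c g = sumF (λ i → if does (a i ≟ c) then g i else 0#)

    AllMedoids : Subset N → (Fin N → Fin N) → Set ℓ
    AllMedoids 𝒞 a = ∀ c → c ∈ 𝒞 → ∀ m → a m ≡ c →
      clusterSum a c (λ i → f i c) ≤ clusterSum a c (λ i → f i m)

    MedlloydLocalMin : Subset N → Set ℓ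
    MedlloydLocalMin 𝒞 = ∀ a → IsAssignment 𝒞 a → AllMedoids 𝒞 a

  dissim : ∀ {a} {X : Set a} {N : ℕ} → (X → X → Carrier) → (Carrier → Carrier) →
           (Fin N → X) → Fin N → Fin N → Carrier
  dissim dist e x i j = e (dist (x i) (x j))

  record Instance {a} (X : Set a) (dist : X → X → Carrier) (e : Carrier → Carrier)
                  (N K : ℕ) (x : Fin N → X) : Set (a ⊔ c ⊔ ℓ) where
    field
      K≥1       : 1 ℕ.≤ K
      K<N       : K ℕ.< N
      metric    : IsMetric dist
      admissible : IsAdmissible e

module Submission where

-- (1) Let c be a center and m ≠ c a member of its cluster; m is not a center, since
-- centers are assigned to themselves.  Moving the whole cluster of c to m is a feasible
-- (if not optimal) assignment for the swapped center set 𝒞 ∖ {c} ∪ {m}, and it changes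
-- no cost outside that cluster.  So clarans' condition E(𝒞) ≤ E(𝒞 ∖ {c} ∪ {m}) yields
-- Σ_{S_c} f(·, c) ≤ Σ_{S_c} f(·, m) after cancelling the common part.
-- (2) On the line ℕ with e = id, take the points 2, 3, 0, 5 and the centers 2 and 3.
-- Every point has a unique nearest center and both clusters {2, 0} and {3, 5} have two
-- points, so each center is a medoid; but swapping the center 2 for the point 0 lowers
-- the total cost from 4 to 3.


open import Defs
open import Level using (Level)
open import Data.Nat using (ℕ)
open import Data.Fin using (Fin)
open import Data.Fin.Subset using (Subset; ∣_∣)
open import Data.Product using (Σ; _×_; _,_)
open import Relation.Nullary using (¬_)
open import Relation.Binary.PropositionalEquality using (_≡_)

open import Algebra.Bundles using (CommutativeRing)
import Algebra.Properties.CommutativeSemigroup as CommutativeSemigroupProperties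
import Algebra.Properties.Group as GroupProperties
import Algebra.Properties.Ring as RingProperties
open import Data.Bool using (true; false; if_then_else_; T)
open import Data.Unit using (tt)
open import Data.Bool.Properties using (if-float)
open import Data.Empty using (⊥-elim)
open import Data.Fin using (zero; suc; _≟_)
open import Data.Fin.Patterns using (0F; 1F; 2F; 3F)
open import Data.Fin.Subset using (_∈_; _∉_; _-_; _∪_; ⁅_⁆; inside; outside)
open import Data.Fin.Subset.Properties using (x∈p∪q⁺; x∈⁅x⁆; x≢y⇒x∉⁅y⁆; x∈p∧x∉q⇒x∈p─q)
open import Data.Maybe using (just; nothing)
open import Data.Product using (∃)
open import Data.Sum using (inj₁; inj₂)
open import Data.Vec using (_∷_; []; here; there)
open import Function using (_∘_; id; mk⇔; Equivalence)
open import Relation.Binary.Bundles using (Poset)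
open import Relation.Binary.PropositionalEquality using (refl; sym; trans; cong; cong₂; subst; subst₂; _≢_)
import Relation.Binary.Reasoning.PartialOrder as PosetReasoning
open import Relation.Binary.Structures using (IsTotalOrder)
open import Relation.Nullary using (does; yes; no; contradiction)
import Data.Nat as ℕ
import Data.Nat.Properties as ℕ
open import Algebra.Definitions.RawMonoid ℕ.+-0-rawMonoid using (sum)

module OrderedFieldProperties {c ℓ} (F : OrderedField c ℓ) where
  open OrderedField F
  open IsTotalOrder isTotalOrder public using (total; isPartialOrder)
    renaming (refl to ≤-refl; trans to ≤-trans; antisym to ≤-antisym)

  commutativeRing : CommutativeRing c c
  commutativeRing = record
    { Carrier = Carrier ; _≈_ = _≡_ ; _+_ = _+_ ; _*_ = _*_ ; -_ = -_
    ; 0# = 0# ; 1# = 1# ; isCommutativeRing = isCommutativeRing }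

  open CommutativeRing commutativeRing public
    using (+-comm; +-assoc; +-identityˡ; +-identityʳ; -‿inverseʳ; *-identityˡ; *-assoc; distribˡ;
           +-group; +-commutativeSemigroup; ring)
  open GroupProperties +-group using (//-rightDividesˡ; //-rightDividesʳ; ⁻¹-involutive)
  open CommutativeSemigroupProperties +-commutativeSemigroup using (interchange)
  open RingProperties ring using (-1*x≈-x)

  poset : Poset c c ℓ
  poset = record { isPartialOrder = isPartialOrder }

  module ≤-Reasoning = PosetReasoning poset

  +-monoʳ-≤ : ∀ {x y} z → x ≤ y → z + x ≤ z + y
  +-monoʳ-≤ {x} {y} z x≤y rewrite +-comm z x | +-comm z y = +-mono-≤ z x≤y

  +-mono-≤₂ : ∀ {x y u v} → x ≤ y → u ≤ v → x + u ≤ y + v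
  +-mono-≤₂ {y = y} {u} x≤y u≤v = ≤-trans (+-mono-≤ u x≤y) (+-monoʳ-≤ y u≤v)

  +-cancelʳ-≤ : ∀ {x y} z → x + z ≤ y + z → x ≤ y
  +-cancelʳ-≤ {x} {y} z x+z≤y+z =
    subst₂ _≤_ (//-rightDividesʳ z x) (//-rightDividesʳ z y) (+-mono-≤ (- z) x+z≤y+z)

  +-cancelˡ-≤ : ∀ {x y} z → z + x ≤ z + y → x ≤ y
  +-cancelˡ-≤ {x} {y} z z+x≤z+y rewrite +-comm z x | +-comm z y = +-cancelʳ-≤ z z+x≤z+y

  0≤1 : 0# ≤ 1#
  -- if 1 ≤ 0 then 0 ≤ -1, hence 0 ≤ (-1)(-1) = 1
  0≤1 with total 0# 1#
  ... | inj₁ 0≤1 = 0≤1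
  ... | inj₂ 1≤0 = subst₂ _≤_ refl (trans (-1*x≈-x (- 1#)) (⁻¹-involutive 1#)) (*-nonneg 0≤-1 0≤-1)
    where
    0≤-1 : 0# ≤ - 1#
    0≤-1 = subst₂ _≤_ (-‿inverseʳ 1#) (+-identityˡ (- 1#)) (+-mono-≤ (- 1#) 1≤0)

  1≰0 : ¬ (1# ≤ 0#)
  1≰0 1≤0 = 0≢1 (≤-antisym 0≤1 1≤0)

  *-monoʳ-≤-nonneg : ∀ {x y z} → 0# ≤ z → x ≤ y → z * x ≤ z * y
  *-monoʳ-≤-nonneg {x} {y} {z} 0≤z x≤y = begin
    z * x                  ≡⟨ +-identityˡ (z * x) ⟨
    0# + z * x             ≤⟨ +-mono-≤ (z * x) (*-nonneg 0≤z 0≤y-x) ⟩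
    z * (y + - x) + z * x  ≡⟨ distribˡ z (y + - x) x ⟨
    z * (y + - x + x)      ≡⟨ cong (z *_) (//-rightDividesˡ x y) ⟩
    z * y                  ∎
    where
    open ≤-Reasoning
    0≤y-x : 0# ≤ y + - x
    0≤y-x = subst₂ _≤_ (-‿inverseʳ x) refl (+-mono-≤ (- x) x≤y)

  ⁻¹*-cancelˡ-≤ : ∀ {x y z} → 0# ≤ z → z ≢ 0# → z ⁻¹ * x ≤ z ⁻¹ * y → x ≤ y
  ⁻¹*-cancelˡ-≤ {x} {y} {z} 0≤z z≢0 le =
    subst₂ _≤_ (z*z⁻¹* x) (z*z⁻¹* y) (*-monoʳ-≤-nonneg 0≤z le)
    where
    z*z⁻¹*_ : ∀ w → z * (z ⁻¹ * w) ≡ w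
    z*z⁻¹* w = trans (sym (*-assoc z (z ⁻¹) w)) (trans (cong (_* w) (⁻¹-inverse z z≢0)) (*-identityˡ w))

  fromℕ-+ : ∀ m n → fromℕ (m ℕ.+ n) ≡ fromℕ m + fromℕ n
  fromℕ-+ ℕ.zero    n = sym (+-identityˡ (fromℕ n))
  fromℕ-+ (ℕ.suc m) n = trans (cong (1# +_) (fromℕ-+ m n)) (sym (+-assoc 1# (fromℕ m) (fromℕ n)))

  fromℕ-nonneg : ∀ n → 0# ≤ fromℕ n
  fromℕ-nonneg ℕ.zero    = ≤-refl
  fromℕ-nonneg (ℕ.suc n) = subst₂ _≤_ (+-identityˡ 0#) refl (+-mono-≤₂ 0≤1 (fromℕ-nonneg n))

  fromℕ-mono-≤ : ∀ {m n} → m ℕ.≤ n → fromℕ m ≤ fromℕ n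
  fromℕ-mono-≤ {n = n} ℕ.z≤n = fromℕ-nonneg n
  fromℕ-mono-≤ (ℕ.s≤s m≤n)  = +-monoʳ-≤ 1# (fromℕ-mono-≤ m≤n)

  1≤fromℕ-suc : ∀ n → 1# ≤ fromℕ (ℕ.suc n)
  1≤fromℕ-suc n = subst₂ _≤_ (+-identityʳ 1#) refl (+-monoʳ-≤ 1# (fromℕ-nonneg n))

  fromℕ-suc≢0 : ∀ n → fromℕ (ℕ.suc n) ≢ 0#
  fromℕ-suc≢0 n eq = 1≰0 (subst₂ _≤_ refl eq (1≤fromℕ-suc n))

  fromℕ≡0⇒≡0 : ∀ {n} → fromℕ n ≡ 0# → n ≡ 0
  fromℕ≡0⇒≡0 {ℕ.zero}  _  = refl
  fromℕ≡0⇒≡0 {ℕ.suc n} eq = ⊥-elim (fromℕ-suc≢0 n eq)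

  fromℕ-cancel-≤ : ∀ {m n} → fromℕ m ≤ fromℕ n → m ℕ.≤ n
  fromℕ-cancel-≤ {ℕ.zero}              _  = ℕ.z≤n
  fromℕ-cancel-≤ {ℕ.suc m} {ℕ.zero}  le = ⊥-elim (1≰0 (≤-trans (1≤fromℕ-suc m) le))
  fromℕ-cancel-≤ {ℕ.suc m} {ℕ.suc n} le = ℕ.s≤s (fromℕ-cancel-≤ (+-cancelˡ-≤ 1# le))

  fromℕ-<⇒≰ : ∀ {m n} → n ℕ.< m → ¬ (fromℕ m ≤ fromℕ n)
  fromℕ-<⇒≰ n<m = ℕ.<⇒≱ n<m ∘ fromℕ-cancel-≤

  fromℕ≢0 : ∀ {n} → Fin n → fromℕ n ≢ 0#
  fromℕ≢0 {ℕ.suc n} _ = fromℕ-suc≢0 n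

  sumF-cong : ∀ {n} {u v : Fin n → Carrier} → (∀ i → u i ≡ v i) → sumF F u ≡ sumF F v
  sumF-cong {ℕ.zero}  u≗v = refl
  sumF-cong {ℕ.suc n} u≗v = cong₂ _+_ (u≗v zero) (sumF-cong (u≗v ∘ suc))

  sumF-+ : ∀ {n} (u v : Fin n → Carrier) → sumF F (λ i → u i + v i) ≡ sumF F u + sumF F v
  sumF-+ {ℕ.zero}  u v = sym (+-identityˡ 0#)
  sumF-+ {ℕ.suc n} u v =
    trans (cong (u zero + v zero +_) (sumF-+ (u ∘ suc) (v ∘ suc))) (interchange _ _ _ _)

  sumF-mono-≤ : ∀ {n} {u v : Fin n → Carrier} → (∀ i → u i ≤ v i) → sumF F u ≤ sumF F v
  sumF-mono-≤ {ℕ.zero}  u≤v = ≤-refl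
  sumF-mono-≤ {ℕ.suc n} u≤v = +-mono-≤₂ (u≤v zero) (sumF-mono-≤ (u≤v ∘ suc))

  sumF-fromℕ : ∀ {n} (h : Fin n → ℕ) → sumF F (fromℕ ∘ h) ≡ fromℕ (sum h)
  sumF-fromℕ {ℕ.zero}  h = refl
  sumF-fromℕ {ℕ.suc n} h =
    trans (cong (fromℕ (h zero) +_) (sumF-fromℕ (h ∘ suc))) (sym (fromℕ-+ (h zero) _))

  min₂-≤ˡ : ∀ x y → min₂ F x y ≤ x
  min₂-≤ˡ x y with total x y
  ... | inj₁ _   = ≤-refl
  ... | inj₂ y≤x = y≤x

  min₂-≤ʳ : ∀ x y → min₂ F x y ≤ y
  min₂-≤ʳ x y with total x y
  ... | inj₁ x≤y = x≤y
  ... | inj₂ _   = ≤-refl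

  min₂-glb : ∀ {z x y} → z ≤ x → z ≤ y → z ≤ min₂ F x y
  min₂-glb {x = x} {y} z≤x z≤y with total x y
  ... | inj₁ _ = z≤x
  ... | inj₂ _ = z≤y

  minOnM-nonempty : ∀ {n} (p : Subset n) g {j} → j ∈ p → ∃ λ m → minOnM F p g ≡ just m
  minOnM-nonempty (inside ∷ p) g here with minOnM F p (g ∘ suc)
  ... | nothing = _ , refl
  ... | just _  = _ , refl
  minOnM-nonempty (b ∷ p) g (there j∈p) with minOnM F p (g ∘ suc) | minOnM-nonempty p (g ∘ suc) j∈p
  minOnM-nonempty (outside ∷ p) g (there j∈p) | just _ | _ = _ , refl
  minOnM-nonempty (inside ∷ p)  g (there j∈p) | just _ | _ = _ , refl

  minOnM-lb : ∀ {n} (p : Subset n) g {m j} → minOnM F p g ≡ just m → j ∈ p → m ≤ g j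
  minOnM-lb (inside ∷ p) g eq here with minOnM F p (g ∘ suc)
  minOnM-lb (inside ∷ p) g refl here | nothing = ≤-refl
  minOnM-lb (inside ∷ p) g refl here | just _  = min₂-≤ˡ _ _
  minOnM-lb (outside ∷ p) g eq (there j∈p) = minOnM-lb p (g ∘ suc) eq j∈p
  minOnM-lb (inside ∷ p) g eq (there j∈p)
    with minOnM F p (g ∘ suc) in eq′ | minOnM-nonempty p (g ∘ suc) j∈p
  minOnM-lb (inside ∷ p) g refl (there j∈p) | just _ | _ =
    ≤-trans (min₂-≤ʳ _ _) (minOnM-lb p (g ∘ suc) eq′ j∈p)

  minOnM-glb : ∀ {n} (p : Subset n) g {m z} → minOnM F p g ≡ just m → (∀ k → k ∈ p → z ≤ g k) → z ≤ m
  minOnM-glb (outside ∷ p) g eq z≤g = minOnM-glb p (g ∘ suc) eq (λ k → z≤g (suc k) ∘ there)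
  minOnM-glb (inside ∷ p) g eq z≤g with minOnM F p (g ∘ suc) in eq′
  minOnM-glb (inside ∷ p) g refl z≤g | nothing = z≤g zero here
  minOnM-glb (inside ∷ p) g refl z≤g | just _  =
    min₂-glb (z≤g zero here) (minOnM-glb p (g ∘ suc) eq′ (λ k → z≤g (suc k) ∘ there))

  minOn-just : ∀ {n} (p : Subset n) g {m} → minOnM F p g ≡ just m → minOn F p g ≡ m
  minOn-just p g eq with minOnM F p g
  minOn-just p g refl | just _ = refl

  minOn-lb : ∀ {n} (p : Subset n) g {j} → j ∈ p → minOn F p g ≤ g j
  minOn-lb p g j∈p with minOnM-nonempty p g j∈p
  ... | _ , eq rewrite minOn-just p g eq = minOnM-lb p g eq j∈p

  minOn-glb : ∀ {n} (p : Subset n) g {j z} → j ∈ p → (∀ k → k ∈ p → z ≤ g k) → z ≤ minOn F p g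
  minOn-glb p g j∈p z≤g with minOnM-nonempty p g j∈p
  ... | _ , eq rewrite minOn-just p g eq = minOnM-glb p g eq z≤g

dissim-self-min : ∀ {a c ℓ} (F : OrderedField c ℓ) {X : Set a} {dist e} {N} →
  IsMetric F dist → IsAdmissible F e → (x : Fin N → X) →
  ∀ i k → OrderedField._≤_ F (dissim F dist e x i i) (dissim F dist e x i k)
dissim-self-min F {dist = dist} {e} metric admissible x i k =
  subst (_≤ e (dist (x i) (x k))) (sym e[dist-x-x]≡0) (nonneg _ (IsMetric.nonneg metric (x i) (x k)))
  where
  open OrderedField F
  open IsAdmissible admissible
  e[dist-x-x]≡0 : e (dist (x i) (x i)) ≡ 0#
  e[dist-x-x]≡0 = trans (cong e (Equivalence.from (IsMetric.zero⇔eq metric (x i) (x i)) refl)) e0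

module KMedoidsProperties {c ℓ} (F : OrderedField c ℓ) (N : ℕ)
                          (f : Fin N → Fin N → OrderedField.Carrier F) where
  open OrderedField F
  open OrderedFieldProperties F
  open KMedoids F N f

  cost : Subset N → Carrier
  cost 𝒞 = sumF F (λ i → minOn F 𝒞 (f i))

  energy-≤⇒cost-≤ : ∀ {𝒞 𝒞′} → Fin N → energy 𝒞 ≤ energy 𝒞′ → cost 𝒞 ≤ cost 𝒞′
  energy-≤⇒cost-≤ i = ⁻¹*-cancelˡ-≤ (fromℕ-nonneg N) (fromℕ≢0 i)

  cost-≤-assignment : ∀ {𝒞} {b : Fin N → Fin N} → (∀ i → b i ∈ 𝒞) → cost 𝒞 ≤ sumF F (λ i → f i (b i))
  cost-≤-assignment {𝒞} b∈𝒞 = sumF-mono-≤ (λ i → minOn-lb 𝒞 (f i) (b∈𝒞 i))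

  minOn-assignment : ∀ {𝒞 a} → IsAssignment 𝒞 a → ∀ i → minOn F 𝒞 (f i) ≡ f i (a i)
  minOn-assignment {𝒞} isA i = ≤-antisym (minOn-lb 𝒞 (f i) (inC i)) (minOn-glb 𝒞 (f i) (inC i) (nearest i))
    where open IsAssignment isA

  cost-assignment : ∀ {𝒞 a} → IsAssignment 𝒞 a → cost 𝒞 ≡ sumF F (λ i → f i (a i))
  cost-assignment isA = sumF-cong (minOn-assignment isA)

  outsideSum : (Fin N → Fin N) → Fin N → (Fin N → Carrier) → Carrier
  outsideSum a c g = sumF F (λ i → if does (a i ≟ c) then 0# else g i)

  sumF-split-cluster : ∀ a c u v →
    sumF F (λ i → if does (a i ≟ c) then u i else v i) ≡ clusterSum a c u + outsideSum a c v
  sumF-split-cluster a c u v = trans (sumF-cong split)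
    (sumF-+ (λ i → if does (a i ≟ c) then u i else 0#) (λ i → if does (a i ≟ c) then 0# else v i))
    where
    split : ∀ i → (if does (a i ≟ c) then u i else v i)
                ≡ (if does (a i ≟ c) then u i else 0#) + (if does (a i ≟ c) then 0# else v i)
    split i with does (a i ≟ c)
    ... | true  = sym (+-identityʳ (u i))
    ... | false = sym (+-identityˡ (v i))

  reassign : (Fin N → Fin N) → Fin N → Fin N → Fin N → Fin N
  reassign a c m i = if does (a i ≟ c) then m else a i

  reassign-∈-swap : ∀ {𝒞 a} → IsAssignment 𝒞 a → ∀ c m i → reassign a c m i ∈ (𝒞 - c) ∪ ⁅ m ⁆
  reassign-∈-swap {a = a} isA c m i with a i ≟ c
  ... | yes _    = x∈p∪q⁺ (inj₂ (x∈⁅x⁆ m))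
  ... | no ai≢c = x∈p∪q⁺ (inj₁ (x∈p∧x∉q⇒x∈p─q (IsAssignment.inC isA i) (x≢y⇒x∉⁅y⁆ ai≢c)))

  sumF-assigned-split : ∀ a c →
    sumF F (λ i → f i (a i)) ≡ clusterSum a c (λ i → f i c) + outsideSum a c (λ i → f i (a i))
  sumF-assigned-split a c = trans (sumF-cong inCluster) (sumF-split-cluster a c _ _)
    where
    inCluster : ∀ i → f i (a i) ≡ (if does (a i ≟ c) then f i c else f i (a i))
    inCluster i with a i ≟ c
    ... | yes ai≡c = cong (f i) ai≡c
    ... | no _     = refl

  sumF-reassigned-split : ∀ a c m →
    sumF F (λ i → f i (reassign a c m i)) ≡ clusterSum a c (λ i → f i m) + outsideSum a c (λ i → f i (a i))
  sumF-reassigned-split a c m =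
    trans (sumF-cong (λ i → if-float (f i) (does (a i ≟ c)))) (sumF-split-cluster a c _ _)

  claransLocalMin⇒medlloydLocalMin : ∀ 𝒞 → ClaransLocalMin 𝒞 → MedlloydLocalMin 𝒞
  claransLocalMin⇒medlloydLocalMin 𝒞 clarans a isA c c∈𝒞 m am≡c with m ≟ c
  ... | yes refl = ≤-refl
  ... | no m≢c   = +-cancelʳ-≤ (outsideSum a c (λ i → f i (a i))) (begin
    clusterSum a c (λ i → f i c) + outsideSum a c (λ i → f i (a i))
      ≡⟨ sumF-assigned-split a c ⟨
    sumF F (λ i → f i (a i))
      ≡⟨ cost-assignment isA ⟨
    cost 𝒞
      ≤⟨ energy-≤⇒cost-≤ c (clarans c m c∈𝒞 m∉𝒞) ⟩
    cost ((𝒞 - c) ∪ ⁅ m ⁆)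
      ≤⟨ cost-≤-assignment (reassign-∈-swap isA c m) ⟩
    sumF F (λ i → f i (reassign a c m i))
      ≡⟨ sumF-reassigned-split a c m ⟩
    clusterSum a c (λ i → f i m) + outsideSum a c (λ i → f i (a i))
      ∎)
    where
    open ≤-Reasoning
    m∉𝒞 : m ∉ 𝒞
    m∉𝒞 m∈𝒞 = m≢c (trans (sym (IsAssignment.selfC isA m m∈𝒞)) am≡c)

  StrictlyNearest : Subset N → (Fin N → Fin N) → Set ℓ
  StrictlyNearest 𝒞 b = ∀ i k → k ∈ 𝒞 → k ≢ b i → ¬ (f i k ≤ f i (b i))

  strictlyNearest⇒isAssignment : ∀ {𝒞 b} → (∀ i k → f i i ≤ f i k) →
    (∀ i → b i ∈ 𝒞) → StrictlyNearest 𝒞 b → IsAssignment 𝒞 b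
  strictlyNearest⇒isAssignment {𝒞} {b} self-min b∈𝒞 strict = record
    { inC = b∈𝒞 ; nearest = nearest ; selfC = selfC }
    where
    nearest : ∀ i k → k ∈ 𝒞 → f i (b i) ≤ f i k
    nearest i k k∈𝒞 with k ≟ b i | total (f i (b i)) (f i k)
    ... | yes refl | _          = ≤-refl
    ... | no _     | inj₁ bi≤k = bi≤k
    ... | no k≢bi  | inj₂ k≤bi = ⊥-elim (strict i k k∈𝒞 k≢bi k≤bi)
    selfC : ∀ k → k ∈ 𝒞 → b k ≡ k
    selfC k k∈𝒞 with b k ≟ k
    ... | yes bk≡k = bk≡k
    ... | no bk≢k  = ⊥-elim (strict k k k∈𝒞 (bk≢k ∘ sym) (self-min k (b k)))

  strictlyNearest⇒unique : ∀ {𝒞 a b} → IsAssignment 𝒞 a →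
    (∀ i → b i ∈ 𝒞) → StrictlyNearest 𝒞 b → ∀ i → a i ≡ b i
  strictlyNearest⇒unique {a = a} {b} isA b∈𝒞 strict i with a i ≟ b i
  ... | yes ai≡bi = ai≡bi
  ... | no ai≢bi  = ⊥-elim (strict i (a i) (inC i) ai≢bi (nearest i (b i) (b∈𝒞 i)))
    where open IsAssignment isA

  clusterSum-cong : ∀ {a b} → (∀ i → a i ≡ b i) → ∀ c g → clusterSum a c g ≡ clusterSum b c g
  clusterSum-cong a≗b c g = sumF-cong (λ i → cong (λ ai → if does (ai ≟ c) then g i else 0#) (a≗b i))

  clusterSum-fromℕ : ∀ a c (h : Fin N → ℕ) →
    clusterSum a c (fromℕ ∘ h) ≡ fromℕ (sum (λ i → if does (a i ≟ c) then h i else 0))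
  clusterSum-fromℕ a c h =
    trans (sumF-cong (λ i → sym (if-float fromℕ (does (a i ≟ c)) {h i} {0})))
          (sumF-fromℕ (λ i → if does (a i ≟ c) then h i else 0))

  allMedoids⇒medlloydLocalMin : ∀ {𝒞 b} → (∀ i → b i ∈ 𝒞) → StrictlyNearest 𝒞 b →
    AllMedoids 𝒞 b → MedlloydLocalMin 𝒞
  allMedoids⇒medlloydLocalMin {b = b} b∈𝒞 strict medoids a isA c c∈𝒞 m am≡c =
    subst₂ _≤_ (sym (clusterSum-cong a≗b c _)) (sym (clusterSum-cong a≗b c _))
      (medoids c c∈𝒞 m (trans (sym (a≗b m)) am≡c))
    where
    a≗b : ∀ i → a i ≡ b i
    a≗b = strictlyNearest⇒unique isA b∈𝒞 strict

module Counterexample {c ℓ} (F : OrderedField c ℓ) where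
  open OrderedField F
  open OrderedFieldProperties F

  dist : ℕ → ℕ → Carrier
  dist m n = fromℕ ℕ.∣ m - n ∣

  dist-isMetric : IsMetric F dist
  dist-isMetric = record
    { nonneg   = λ m n → fromℕ-nonneg ℕ.∣ m - n ∣
    ; zero⇔eq  = λ m n →
        mk⇔ (ℕ.∣m-n∣≡0⇒m≡n ∘ fromℕ≡0⇒≡0) (λ { refl → cong fromℕ (ℕ.∣n-n∣≡0 m) })
    ; sym      = λ m n → cong fromℕ (ℕ.∣-∣-comm m n)
    ; triangle = λ m n o →
        subst₂ _≤_ refl (fromℕ-+ ℕ.∣ m - n ∣ ℕ.∣ n - o ∣) (fromℕ-mono-≤ (ℕ.∣-∣-triangle m n o))
    }

  id-isAdmissible : IsAdmissible F id
  id-isAdmissible = record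
    { nonneg = λ _ 0≤v → 0≤v
    ; e0     = refl
    ; mono⇔  = λ _ _ _ _ → mk⇔ id id
    }

  position : Fin 4 → ℕ
  position 0F = 2
  position 1F = 3
  position 2F = 0
  position 3F = 5

  lineInstance : Instance F ℕ dist id 4 2 position
  lineInstance = record
    { K≥1        = ℕ.s≤s ℕ.z≤n
    ; K<N        = ℕ.s≤s (ℕ.s≤s (ℕ.s≤s ℕ.z≤n))
    ; metric     = dist-isMetric
    ; admissible = id-isAdmissible
    }

  d : Fin 4 → Fin 4 → ℕ
  d i j = ℕ.∣ position i - position j ∣

  f : Fin 4 → Fin 4 → Carrier
  f = dissim F dist id position

  open KMedoids F 4 f
  open KMedoidsProperties F 4 f

  centers : Subset 4
  centers = inside ∷ inside ∷ outside ∷ outside ∷ []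

  nearestCenter : Fin 4 → Fin 4
  nearestCenter 0F = 0F
  nearestCenter 1F = 1F
  nearestCenter 2F = 0F
  nearestCenter 3F = 1F

  nearestCenter-∈ : ∀ i → nearestCenter i ∈ centers
  nearestCenter-∈ 0F = here
  nearestCenter-∈ 1F = there here
  nearestCenter-∈ 2F = here
  nearestCenter-∈ 3F = there here

  farther : ∀ i k → T (d i (nearestCenter i) ℕ.<ᵇ d i k) → ¬ (f i k ≤ f i (nearestCenter i))
  farther i k lt = fromℕ-<⇒≰ (ℕ.<ᵇ⇒< (d i (nearestCenter i)) (d i k) lt)

  nearestCenter-strict : StrictlyNearest centers nearestCenter
  nearestCenter-strict 0F 1F _ _ = farther 0F 1F tt
  nearestCenter-strict 1F 0F _ _ = farther 1F 0F tt
  nearestCenter-strict 2F 1F _ _ = farther 2F 1F tt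
  nearestCenter-strict 3F 0F _ _ = farther 3F 0F tt
  nearestCenter-strict 0F 0F _ k≢ = contradiction refl k≢
  nearestCenter-strict 1F 1F _ k≢ = contradiction refl k≢
  nearestCenter-strict 2F 0F _ k≢ = contradiction refl k≢
  nearestCenter-strict 3F 1F _ k≢ = contradiction refl k≢
  nearestCenter-strict _ 2F (there (there ())) _
  nearestCenter-strict _ 3F (there (there (there ()))) _

  clusterSum-≤ : ∀ c m →
    sum (λ i → if does (nearestCenter i ≟ c) then d i c else 0) ℕ.≤
    sum (λ i → if does (nearestCenter i ≟ c) then d i m else 0) →
    clusterSum nearestCenter c (λ i → f i c) ≤ clusterSum nearestCenter c (λ i → f i m)
  clusterSum-≤ c m le =
    subst₂ _≤_ (sym (clusterSum-fromℕ nearestCenter c (λ i → d i c)))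
               (sym (clusterSum-fromℕ nearestCenter c (λ i → d i m))) (fromℕ-mono-≤ le)

  nearestCenter-medoids : AllMedoids centers nearestCenter
  nearestCenter-medoids 0F _ 0F _ = ≤-refl
  nearestCenter-medoids 0F _ 2F _ = clusterSum-≤ 0F 2F ℕ.≤-refl
  nearestCenter-medoids 1F _ 1F _ = ≤-refl
  nearestCenter-medoids 1F _ 3F _ = clusterSum-≤ 1F 3F ℕ.≤-refl
  nearestCenter-medoids 0F _ 1F ()
  nearestCenter-medoids 0F _ 3F ()
  nearestCenter-medoids 1F _ 0F ()
  nearestCenter-medoids 1F _ 2F ()
  nearestCenter-medoids 2F (there (there ())) _ _
  nearestCenter-medoids 3F (there (there (there ()))) _ _

  medlloydLocalMin : MedlloydLocalMin centers
  medlloydLocalMin =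
    allMedoids⇒medlloydLocalMin nearestCenter-∈ nearestCenter-strict nearestCenter-medoids

  swapped : Subset 4
  swapped = (centers - 0F) ∪ ⁅ 2F ⁆

  swappedCenter : Fin 4 → Fin 4
  swappedCenter 0F = 1F
  swappedCenter 1F = 1F
  swappedCenter 2F = 2F
  swappedCenter 3F = 1F

  swappedCenter-∈ : ∀ i → swappedCenter i ∈ swapped
  swappedCenter-∈ 0F = there here
  swappedCenter-∈ 1F = there here
  swappedCenter-∈ 2F = there (there here)
  swappedCenter-∈ 3F = there here

  nearestCenter-isAssignment : IsAssignment centers nearestCenter
  nearestCenter-isAssignment = strictlyNearest⇒isAssignment
    (dissim-self-min F dist-isMetric id-isAdmissible position) nearestCenter-∈ nearestCenter-strict

  ¬claransLocalMin : ¬ ClaransLocalMin centers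
  ¬claransLocalMin clarans = fromℕ-<⇒≰ (ℕ.<ᵇ⇒< 3 4 tt) (begin
    fromℕ 4
      ≡⟨ sumF-fromℕ (λ i → d i (nearestCenter i)) ⟨
    sumF F (λ i → f i (nearestCenter i))
      ≡⟨ cost-assignment {centers} nearestCenter-isAssignment ⟨
    cost centers
      ≤⟨ energy-≤⇒cost-≤ {centers} {swapped} 0F (clarans 0F 2F here 2F∉centers) ⟩
    cost swapped
      ≤⟨ cost-≤-assignment {swapped} swappedCenter-∈ ⟩
    sumF F (λ i → f i (swappedCenter i))
      ≡⟨ sumF-fromℕ (λ i → d i (swappedCenter i)) ⟩
    fromℕ 3
      ∎)
    where
    open ≤-Reasoning
    2F∉centers : 2F ∉ centers
    2F∉centers (there (there ()))

theorem1 : ∀ {a c ℓ : Level} (F : OrderedField c ℓ) →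
    let open OrderedField F using (Carrier) in
    ((X : Set a) (dist : X → X → Carrier) (e : Carrier → Carrier)
    (N K : ℕ) (x : Fin N → X) → Instance F X dist e N K x →
    (𝒞 : Subset N) → ∣ 𝒞 ∣ ≡ K →
    KMedoids.ClaransLocalMin F N (dissim F dist e x) 𝒞 →
    KMedoids.MedlloydLocalMin F N (dissim F dist e x) 𝒞)
    ×
    Σ Set λ X → Σ (X → X → Carrier) λ dist → Σ (Carrier → Carrier) λ e →
    Σ ℕ λ N → Σ ℕ λ K → Σ (Fin N → X) λ x →
    Instance F X dist e N K x ×
    Σ (Subset N) λ 𝒞 → ∣ 𝒞 ∣ ≡ K ×
    KMedoids.MedlloydLocalMin F N (dissim F dist e x) 𝒞 ×
    ¬ KMedoids.ClaransLocalMin F N (dissim F dist e x) 𝒞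
theorem1 F =
  (λ X dist e N K x _ 𝒞 _ → claransLocalMin⇒medlloydLocalMin F N (dissim F dist e x) 𝒞) ,
  (ℕ , dist , id , 4 , 2 , position , lineInstance , centers , refl , medlloydLocalMin , ¬claransLocalMin)
  where
  open KMedoidsProperties using (claransLocalMin⇒medlloydLocalMin)
  open Counterexample F
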